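{- Let $\mathbf{A},\mathbf{B}\in\mathcal{S}$ be such that $\mathbf{A}$ contains a complete order and there is a homomorphism $h:\mathbf{A}\to\mathbf{B}$. Then $\mathbf{B}$ contains a complete order.
   Context: $\tau$ is the signature with binary relation symbols $O,S$ and unary $P$. For $n\in\mathbb{N}$, $L_n$ is the $\tau$-structure with universe $\{1,\dots,n\}$, $O^{L_n}=\{(i,j):i<j\}$, $S^{L_n}=\{(i,i+1):1\le i<n\}$, $P^{L_n}=\{1,n\}$. Substructures are not necessarily induced ($A\subseteq B$, $R^{\mathbf{A}}\subseteq R^{\mathbf{B}}$). Disjoint union $\mathbf{A}\oplus\mathbf{B}$ takes the disjoint union of universes and of relations. $\mathcal{S}$ is the closure of the class of structures isomorphic to some $L_n$ under taking substructures and disjoint unions (so every member of $\mathcal{S}$ is isomorphic to a disjoint union of finitely many structures each of which is a substructure of some $L_n$). A structure $\mathbf{A}\in\mathcal{S}$ contains a complete order if there is $n\ge 2$ such that $L_n$ is isomorphic to a substructure of $\mathbf{A}$. A homomorphism is a relation-preserving map. -}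

module Defs where

open import Data.Nat using (ℕ; zero; suc; _≥_)
open import Data.Fin using (Fin; toℕ) renaming (_<_ to _<ᶠ_)
open import Data.Empty using (⊥)
open import Data.Sum using (_⊎_; inj₁; inj₂)
open import Data.Product using (Σ; _×_; _,_; proj₁; ∃)
open import Relation.Binary.PropositionalEquality using (_≡_)
open import Function.Bundles using (_↔_; Inverse)

record Str : Set₁ where
  field
    Carrier : Set
    O S     : Carrier → Carrier → Set
    P       : Carrier → Set
open Str public

-- L_n with universe Fin n = {0,…,n-1} (a relabelling of {1,…,n})
L : ℕ → Str
L n = record
  { Carrier = Fin n
  ; O = λ i j → i <ᶠ j
  ; S = λ i j → toℕ j ≡ suc (toℕ i)
  ; P = λ i → (toℕ i ≡ 0) ⊎ (suc (toℕ i) ≡ n)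
  }

-- a (not necessarily induced) substructure of A: a subset U of the universe
-- and relations contained in those of A, living on U
record Sub (A : Str) : Set₁ where
  field
    U     : Carrier A → Set
    O' S' : Carrier A → Carrier A → Set
    P'    : Carrier A → Set
    O'⊆   : ∀ {x y} → O' x y → O A x y × (U x × U y)
    S'⊆   : ∀ {x y} → S' x y → S A x y × (U x × U y)
    P'⊆   : ∀ {x} → P' x → P A x × U x
open Sub public

toStr : {A : Str} → Sub A → Str
toStr {A} C = record
  { Carrier = Σ (Carrier A) (U C)
  ; O = λ x y → O' C (proj₁ x) (proj₁ y)
  ; S = λ x y → S' C (proj₁ x) (proj₁ y)
  ; P = λ x → P' C (proj₁ x)
  }

record _≅_ (A B : Str) : Set₁ where
  field
    bij  : Carrier A ↔ Carrier B
  f : Carrier A → Carrier B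
  f = Inverse.to bij
  field
    O-pres : ∀ x y → O A x y → O B (f x) (f y)
    O-refl : ∀ x y → O B (f x) (f y) → O A x y
    S-pres : ∀ x y → S A x y → S B (f x) (f y)
    S-refl : ∀ x y → S B (f x) (f y) → S A x y
    P-pres : ∀ x → P A x → P B (f x)
    P-refl : ∀ x → P B (f x) → P A x

_⊕_ : Str → Str → Str
A ⊕ B = record
  { Carrier = Carrier A ⊎ Carrier B
  ; O = rel (O A) (O B)
  ; S = rel (S A) (S B)
  ; P = un (P A) (P B)
  }
  where
  rel : (Carrier A → Carrier A → Set) → (Carrier B → Carrier B → Set)
      → Carrier A ⊎ Carrier B → Carrier A ⊎ Carrier B → Set
  rel R R' (inj₁ x) (inj₁ y) = R x y
  rel R R' (inj₂ x) (inj₂ y) = R' x y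
  rel R R' _ _ = ⊥
  un : (Carrier A → Set) → (Carrier B → Set) → Carrier A ⊎ Carrier B → Set
  un Q Q' (inj₁ x) = Q x
  un Q Q' (inj₂ x) = Q' x

data InS : Str → Set₂ where
  base : ∀ n → InS (L n)
  iso  : ∀ {A B} → InS A → A ≅ B → InS B
  sub  : ∀ {A} → InS A → (C : Sub A) → InS (toStr C)
  sum  : ∀ {A B} → InS A → InS B → InS (A ⊕ B)

ContainsCompleteOrder : Str → Set₁
ContainsCompleteOrder A = Σ ℕ λ n → (n ≥ 2) × Σ (Sub A) λ C → L n ≅ toStr C

record Hom (A B : Str) : Set where
  field
    h : Carrier A → Carrier B
    O-pres : ∀ x y → O A x y → O B (h x) (h y)
    S-pres : ∀ x y → S A x y → S B (h x) (h y)
    P-pres : ∀ x → P A x → P B (h x)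

-- A complete order in A yields a homomorphism L n → A, and composing with h gives
-- a homomorphism g : L n → B.
-- Every structure in 𝒮 has an irreflexive O, and O holds between any two distinct
-- points of L n, so g is injective; an injective homomorphism is an isomorphism
-- onto its image, which is therefore a complete order in B.
module Submission where

open import Defs
open import Data.Sum using (inj₁; inj₂)
open import Data.Fin.Properties using (<-cmp; <-irrefl)
open import Data.Empty using (⊥-elim)
open import Data.Product using (Σ; _,_; proj₁; proj₂)
open import Function.Base using (_∘_)
open import Function.Bundles using (Inverse; mk↔ₛ′)
open import Function.Definitions using (Injective)
open import Relation.Binary.Definitions using (tri<; tri≈; tri>)
open import Relation.Binary.PropositionalEquality using (_≡_; refl; sym; subst; subst₂)
open import Relation.Nullary using (¬_)

O-Irreflexive : Str → Set
O-Irreflexive B = ∀ x → ¬ O B x x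

InS⇒O-irreflexive : ∀ {B} → InS B → O-Irreflexive B
InS⇒O-irreflexive (base n) x = <-irrefl refl
InS⇒O-irreflexive {B} (iso {A} s e) x Oxx =
  InS⇒O-irreflexive s x′ (O-refl x′ x′ (subst (λ z → O B z z) (sym (Inverse.strictlyInverseˡ bij x)) Oxx))
  where
  open _≅_ e
  x′ : Carrier A
  x′ = Inverse.from bij x
InS⇒O-irreflexive (sub s C) (x , _) Oxx = InS⇒O-irreflexive s x (proj₁ (O'⊆ C Oxx))
InS⇒O-irreflexive (sum s t) (inj₁ x) = InS⇒O-irreflexive s x
InS⇒O-irreflexive (sum s t) (inj₂ x) = InS⇒O-irreflexive t x

_∘ʰ_ : ∀ {A B C} → Hom B C → Hom A B → Hom A C
g ∘ʰ f = record
  { h      = Hom.h g ∘ Hom.h f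
  ; O-pres = λ x y → Hom.O-pres g _ _ ∘ Hom.O-pres f x y
  ; S-pres = λ x y → Hom.S-pres g _ _ ∘ Hom.S-pres f x y
  ; P-pres = λ x → Hom.P-pres g _ ∘ Hom.P-pres f x
  }

≅⇒Hom : ∀ {A B} → A ≅ B → Hom A B
≅⇒Hom e = record { h = f ; O-pres = O-pres ; S-pres = S-pres ; P-pres = P-pres }
  where open _≅_ e

Sub-inclusion : ∀ {A} (C : Sub A) → Hom (toStr C) A
Sub-inclusion C = record
  { h      = proj₁
  ; O-pres = λ _ _ → proj₁ ∘ O'⊆ C
  ; S-pres = λ _ _ → proj₁ ∘ S'⊆ C
  ; P-pres = λ _ → proj₁ ∘ P'⊆ C
  }

module _ {A B : Str} (g : Hom A B) where
  open Hom g

  image : Sub B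
  image = record
    { U   = λ y → Σ (Carrier A) λ x → h x ≡ y
    ; O'  = λ y y′ → Σ (Carrier A) λ x → Σ (Carrier A) λ x′ → Σ (O A x x′) λ _ → Σ (h x ≡ y) λ _ → h x′ ≡ y′
    ; S'  = λ y y′ → Σ (Carrier A) λ x → Σ (Carrier A) λ x′ → Σ (S A x x′) λ _ → Σ (h x ≡ y) λ _ → h x′ ≡ y′
    ; P'  = λ y → Σ (Carrier A) λ x → Σ (P A x) λ _ → h x ≡ y
    ; O'⊆ = λ { (x , x′ , r , refl , refl) → O-pres x x′ r , (x , refl) , (x′ , refl) }
    ; S'⊆ = λ { (x , x′ , r , refl , refl) → S-pres x x′ r , (x , refl) , (x′ , refl) }
    ; P'⊆ = λ { (x , p , refl) → P-pres x p , (x , refl) }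
    }

  injective⇒≅image : Injective _≡_ _≡_ h → A ≅ toStr image
  injective⇒≅image inj = record
    { bij    = mk↔ₛ′ (λ x → h x , x , refl) (proj₁ ∘ proj₂) to∘from≡id (λ _ → refl)
    ; O-pres = λ x x′ r → x , x′ , r , refl , refl
    ; O-refl = λ { x x′ (z , z′ , r , p , p′) → subst₂ (O A) (inj p) (inj p′) r }
    ; S-pres = λ x x′ r → x , x′ , r , refl , refl
    ; S-refl = λ { x x′ (z , z′ , r , p , p′) → subst₂ (S A) (inj p) (inj p′) r }
    ; P-pres = λ x p → x , p , refl
    ; P-refl = λ { x (z , p , q) → subst (P A) (inj q) p }
    }
    where
    to∘from≡id : ∀ (y : Σ (Carrier B) (U image)) → (h (proj₁ (proj₂ y)) , proj₁ (proj₂ y) , refl) ≡ y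
    to∘from≡id (_ , _ , refl) = refl

Hom-from-L-injective : ∀ {n B} → O-Irreflexive B → (g : Hom (L n) B) → Injective _≡_ _≡_ (Hom.h g)
Hom-from-L-injective {B = B} irr g {i} {j} gi≡gj with <-cmp i j
... | tri< i<j _ _ = ⊥-elim (irr _ (subst (λ z → O B z (Hom.h g j)) gi≡gj (Hom.O-pres g i j i<j)))
... | tri≈ _ i≡j _ = i≡j
... | tri> _ _ j<i = ⊥-elim (irr _ (subst (λ z → O B z (Hom.h g i)) (sym gi≡gj) (Hom.O-pres g j i j<i)))

mainTheorem9 : (A B : Str) → InS A → InS B → ContainsCompleteOrder A → Hom A B → ContainsCompleteOrder B
mainTheorem9 A B _ sB (n , n≥2 , C , Lₙ≅C) hom =
  n , n≥2 , image g , injective⇒≅image g (Hom-from-L-injective (InS⇒O-irreflexive sB) g)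
  where
  g : Hom (L n) B
  g = hom ∘ʰ (Sub-inclusion C ∘ʰ ≅⇒Hom Lₙ≅C)
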